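{- Let $G$ be a group and $A\subseteq G$. If $A$ does not have $\ell$-$\mathrm{OP}$ for some $\ell$, then it does not have $\ell$-$\mathrm{HOP}_2$.
   Context: $A\subseteq G$ has $\ell$-$\mathrm{OP}$ if there are $a_1,\dots,a_\ell,b_1,\dots,b_\ell\in G$ with $a_i\cdot b_j\in A\iff i\le j$. $A$ has $\ell$-$\mathrm{HOP}_2$ if there are $x_1,\dots,x_\ell,y_1,\dots,y_\ell,z_1,\dots,z_\ell\in G$ with $x_i\cdot y_j\cdot z_k\in A\iff i<j+k$. -}

module Defs where

open import Level using (Level; _⊔_)
open import Algebra.Bundles using (Group)
open import Data.Nat using (ℕ; _≤_; _<_; _+_)
import Data.Nat
open import Data.Fin using (Fin; toℕ)
open import Data.Product using (Σ-syntax; _×_)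
open import Function.Bundles using (_⇔_)
open import Relation.Unary using (Pred)

module _ {c ℓ : Level} (G : Group c ℓ) where
  open Group G

  -- Indices 1..n are represented by Fin n (i.e. 0..n-1); i ≤ j is unchanged.
  -- A has n-OP: ∃ a₁..aₙ, b₁..bₙ with aᵢ·bⱼ ∈ A ⇔ i ≤ j.
  HasOP : ∀ {p} → Pred Carrier p → ℕ → Set (c ⊔ p)
  HasOP A n = Σ[ a ∈ (Fin n → Carrier) ] Σ[ b ∈ (Fin n → Carrier) ]
    (∀ i j → A (a i ∙ b j) ⇔ (toℕ i ≤ toℕ j))

  -- A has n-HOP₂: ∃ x, y, z with xᵢ·yⱼ·z_k ∈ A ⇔ i < j + k  (1-based indices).
  -- With 0-based i' = i-1 etc: i < j + k ⇔ i'+1 < (j'+1)+(k'+1) ⇔ i' < 1 + (j' + k').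
  HasHOP₂ : ∀ {p} → Pred Carrier p → ℕ → Set (c ⊔ p)
  HasHOP₂ A n = Σ[ x ∈ (Fin n → Carrier) ] Σ[ y ∈ (Fin n → Carrier) ] Σ[ z ∈ (Fin n → Carrier) ]
    (∀ i j k → A ((x i ∙ y j) ∙ z k) ⇔ (toℕ i < Data.Nat.suc (toℕ j + toℕ k)))

{-# OPTIONS --safe #-}
module Submission where

-- Freezing the last coordinate of a HOP₂ witness at the first index turns
-- xᵢ·yⱼ·z₁ ∈ A ⇔ i < j + 1 into an OP witness with aᵢ = xᵢ and bⱼ = yⱼ·z₁.

open import Defs
open import Level using (Level)
open import Algebra.Bundles using (Group)
open import Data.Nat using (ℕ; zero; suc; _+_; _≤_; _<_; s≤s)
open import Data.Nat.Properties using (+-identityʳ; m<1+n⇒m≤n)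
open import Data.Fin using (toℕ) renaming (zero to fzero)
open import Data.Product using (_,_)
open import Function.Bundles using (_⇔_; mk⇔)
import Function.Properties.Equivalence as ⇔
open import Relation.Nullary using (¬_)
open import Relation.Unary using (Pred)
open import Relation.Binary.Definitions using (_Respects_)

m<1+n+0⇔m≤n : ∀ m n → m < suc (n + 0) ⇔ m ≤ n
m<1+n+0⇔m≤n m n rewrite +-identityʳ n = mk⇔ m<1+n⇒m≤n s≤s

module _ {c ℓ p : Level} (G : Group c ℓ) {A : Pred (Group.Carrier G) p}
         (A-resp : A Respects (Group._≈_ G)) where
  open Group G

  A-cong : ∀ {u v} → u ≈ v → A u ⇔ A v
  A-cong u≈v = mk⇔ (A-resp u≈v) (A-resp (sym u≈v))

  hasHOP₂⇒hasOP : ∀ n → HasHOP₂ G A n → HasOP G A n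
  hasHOP₂⇒hasOP zero    _             = (λ ()) , (λ ()) , λ ()
  hasHOP₂⇒hasOP (suc n) (x , y , z , xyz∈A⇔) =
    x , (λ j → y j ∙ z fzero) , λ i j →
      ⇔.trans (A-cong (sym (assoc (x i) (y j) (z fzero))))
        (⇔.trans (xyz∈A⇔ i j fzero) (m<1+n+0⇔m≤n (toℕ i) (toℕ j)))

lemma2p4 : ∀ {c ℓ p : Level} (G : Group c ℓ) (A : Pred (Group.Carrier G) p) →
    A Respects (Group._≈_ G) → (n : ℕ) → ¬ HasOP G A n → ¬ HasHOP₂ G A n
lemma2p4 G A A-resp n ¬op hop = ¬op (hasHOP₂⇒hasOP G A-resp n hop)
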